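{- Let $S$ be a quasi-tree of a map $\mathcal M$. If $e\in S$, then $\widetilde\Lambda(\mathcal M/ e,S\setminus\{e\})=\widetilde\Lambda(\mathcal M,S)-e$. If $e\notin S$, then $\widetilde\Lambda(\mathcal M\setminus e,S)=\widetilde\Lambda(\mathcal M,S)-e$. Here $-e$ denotes removal of the chord $e$ (and its two endpoints) from the bicolored chord diagram.
   Context: A map is a triple $\mathcal M=(B,\sigma,\alpha)$ with $B$ a finite set (of flags), $\sigma,\alpha\in\mathrm{Sym}(B)$, $\alpha$ a fixed-point-free involution, $\langle\sigma,\alpha\rangle$ transitive on $B$; permutations compose as functions. Edges are cycles of $\alpha$; $\underline b=\{b,\alpha(b)\}$. The tour of a set $F$ of edges is $\tau$ with $\tau(b)=\sigma\alpha(b)$ if $\underline b\in F$, $\tau(b)=\sigma(b)$ otherwise; a quasi-tree is a set of edges whose tour is a single cycle on the flag set. For $\mu\in\mathrm{Sym}(B)$, $B'\subseteq B$: $\mu_{|B'}(b)=\mu^k(b)$ for $b\in B'$, $k\ge1$ least with $\mu^k(b)\in B'$. Deletion: $\mathcal M\setminus e=(B\setminus e,\sigma_{|B\setminus e},\alpha_{|B\setminus e})$; contraction: $\mathcal M/e=(B\setminus e,(\sigma\alpha)_{|B\setminus e}\alpha_{|B\setminus e},\alpha_{|B\setminus e})$. For a quasi-tree $S$ with tour $\tau$, $\widetilde\Lambda(\mathcal M,S)$ is the chord diagram with the flags placed on a circle in the cyclic order of $\tau$, a chord joining the two flags of each edge, chords of edges in $S$ colored 1 and the others colored 2. -}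

module Defs where

open import Data.Nat using (ℕ; zero; suc; _≡ᵇ_)
open import Data.Bool using (Bool; true; false; if_then_else_; not; _∧_; _∨_)
open import Data.List using (List; filter; length)
open import Data.List.Membership.Propositional using (_∈_)
open import Data.List.Relation.Unary.Unique.Propositional using (Unique)
open import Data.Product using (Σ; _×_; ∃)
open import Relation.Binary.PropositionalEquality using (_≡_; _≢_)
open import Relation.Nullary using (¬_)
open import Relation.Unary using (Pred)
open import Function.Bundles using (_⇔_)
open import Data.Bool using (T)
open import Relation.Nullary.Decidable using (does)

-- Permutations of B are functions ℕ → ℕ whose
-- behaviour outside B is irrelevant.  Composition is as functions:
-- (σ α) b = σ (α b).

iter : (ℕ → ℕ) → ℕ → ℕ → ℕ
iter f zero    b = b
iter f (suc k) b = f (iter f k b)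

IsPermOn : List ℕ → (ℕ → ℕ) → Set
IsPermOn B f = (∀ b → b ∈ B → f b ∈ B)
             × (∀ b c → b ∈ B → c ∈ B → f b ≡ f c → b ≡ c)

-- c is reachable from b using σ and α (for permutations of a finite set,
-- this is the orbit relation of the group ⟨σ, α⟩)
data Reach (σ α : ℕ → ℕ) : ℕ → ℕ → Set where
  here  : ∀ {b} → Reach σ α b b
  σstep : ∀ {b c} → Reach σ α (σ b) c → Reach σ α b c
  αstep : ∀ {b c} → Reach σ α (α b) c → Reach σ α b c

record PreMap : Set where
  constructor premap
  field
    flags : List ℕ
    σ     : ℕ → ℕ
    α     : ℕ → ℕ
open PreMap public

record IsMap (M : PreMap) : Set where
  field
    unique   : Unique (flags M)
    σ-perm   : IsPermOn (flags M) (σ M)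
    α-perm   : IsPermOn (flags M) (α M)
    α-invol  : ∀ b → b ∈ flags M → α M (α M b) ≡ b
    α-fpf    : ∀ b → b ∈ flags M → α M b ≢ b
    transitive : ∀ b c → b ∈ flags M → c ∈ flags M → Reach (σ M) (α M) b c

-- Edge sets: a set F of edges is given by its indicator on flags,
-- F b = true  iff  the edge {b, α b} belongs to F.

EdgeSet : Set
EdgeSet = ℕ → Bool

IsEdgeSet : PreMap → EdgeSet → Set
IsEdgeSet M F = ∀ b → b ∈ flags M → F (α M b) ≡ F b

tour : PreMap → EdgeSet → ℕ → ℕ
tour M F b = if F b then σ M (α M b) else σ M b

-- quasi-tree: the tour is a single cycle on the flag set
IsQuasiTree : PreMap → EdgeSet → Set
IsQuasiTree M S = IsEdgeSet M S
                × (∀ b → b ∈ flags M → tour M S b ∈ flags M)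
                × (∀ b c → b ∈ flags M → c ∈ flags M →
                     ∃ λ k → iter (tour M S) k b ≡ c)

-- Restriction μ_{|B'}: μ^k(b) for the least k ≥ 1 with μ^k(b) ∈ B'.
-- The subset B' is given by a boolean predicate; fuel bounds the search
-- (fuel = |B| always suffices for a permutation of B and b ∈ B' ⊆ B).

restrictWith : ℕ → (ℕ → ℕ) → (ℕ → Bool) → ℕ → ℕ
restrictWith zero     μ P b = b
restrictWith (suc k)  μ P b = if P (μ b) then μ b else restrictWith k μ P (μ b)

restrict : List ℕ → (ℕ → ℕ) → (ℕ → Bool) → ℕ → ℕ
restrict B μ P = restrictWith (length B) μ P

-- edges are named by one of their flags f: the edge e = {f, α f}
inEdge : PreMap → ℕ → ℕ → Bool
inEdge M f b = (b ≡ᵇ f) ∨ (b ≡ᵇ α M f)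

notInEdge : PreMap → ℕ → ℕ → Bool
notInEdge M f b = not (inEdge M f b)

flagsMinus : PreMap → ℕ → List ℕ
flagsMinus M f = filter (λ b → T? (notInEdge M f b)) (flags M)
  where
    open import Data.Bool.Properties using (T?)

deleteEdge : PreMap → ℕ → PreMap
deleteEdge M f = premap (flagsMinus M f)
                        (restrict (flags M) (σ M) (notInEdge M f))
                        (restrict (flags M) (α M) (notInEdge M f))

contractEdge : PreMap → ℕ → PreMap
contractEdge M f =
  premap (flagsMinus M f)
         (λ b → restrict (flags M) (λ x → σ M (α M x)) (notInEdge M f)
                   (restrict (flags M) (α M) (notInEdge M f) b))
         (restrict (flags M) (α M) (notInEdge M f))

removeFromEdgeSet : PreMap → EdgeSet → ℕ → EdgeSet
removeFromEdgeSet M S f b = S b ∧ notInEdge M f b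

-- Bicoloured chord diagrams on labelled points: the points (a list),
-- the cyclic successor on the circle, the chord partner, and the colour.

data Colour : Set where
  colour1 colour2 : Colour

record ChordDiagram : Set where
  constructor chordDiagram
  field
    points : List ℕ
    next   : ℕ → ℕ
    chord  : ℕ → ℕ
    colour : ℕ → Colour
open ChordDiagram public

_≈CD_ : ChordDiagram → ChordDiagram → Set
D ≈CD E = (∀ x → (x ∈ points D) ⇔ (x ∈ points E))
        × (∀ x → x ∈ points D →
             (next D x ≡ next E x) × (chord D x ≡ chord E x)
             × (colour D x ≡ colour E x))

Λ̃ : PreMap → EdgeSet → ChordDiagram
Λ̃ M S = chordDiagram (flags M) (tour M S) (α M)
          (λ b → if S b then colour1 else colour2)

removeChord : ChordDiagram → ℕ → ChordDiagram
removeChord D f =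
  chordDiagram (filter (λ b → T? (keep b)) (points D))
               (restrict (points D) (next D) keep)
               (restrict (points D) (chord D) keep)
               (colour D)
  where
    open import Data.Bool.Properties using (T?)
    keep : ℕ → Bool
    keep b = not ((b ≡ᵇ f) ∨ (b ≡ᵇ chord D f))

{-# OPTIONS --safe #-}
-- Deleting an edge e ∉ S or contracting an edge e ∈ S changes the tour τ of S only at the
-- two flags of e, where the new vertex rotation follows σ (resp. σα) exactly as τ did there.
-- Hence the tour of the minor is τ restricted to B ∖ e, and the restriction of a single cycle
-- to a subset is again a single cycle. Since only two flags are skipped, every remaining flag
-- comes back to B ∖ e within three steps of τ, which is what the fuel of the restriction needs.
module Submission where

open import Defs
open import Data.Bool using (Bool; true; false; if_then_else_; not; _∧_; _∨_)
open import Data.Bool.Properties using (T-≡; ∧-identityʳ; ∨-zeroʳ)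
open import Data.Empty using (⊥; ⊥-elim)
open import Data.List using (List; length)
open import Data.List.Membership.Propositional using (_∈_)
open import Data.List.Membership.Propositional.Properties using (∈-filter⁺; ∈-filter⁻)
open import Data.List.Relation.Unary.Any using (here; there)
open import Data.Nat using (ℕ; zero; suc; _≤_; _<_; z≤n; s≤s; _≡ᵇ_)
open import Data.Nat.Induction using (<-wellFounded)
open import Data.Nat.Properties using (≡ᵇ⇒≡; ≡⇒≡ᵇ; ≤-refl; m≤n⇒m≤1+n; <-≤-trans)
open import Data.Product using (_×_; ∃; ∃₂; _,_; proj₁; proj₂)
open import Data.Sum using (_⊎_; inj₁; inj₂; [_,_]′) renaming (map to ⊎-map)
open import Function using (id)
open import Function.Bundles using (mk⇔; Equivalence)
open import Induction.WellFounded using (Acc; acc)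
open import Relation.Binary.PropositionalEquality
  using (_≡_; _≢_; refl; sym; trans; cong; subst; module ≡-Reasoning)

open ≡-Reasoning

≡true⇒≢false : ∀ {b : Bool} → b ≡ true → b ≢ false
≡true⇒≢false refl ()

≡ᵇ-refl : ∀ m → (m ≡ᵇ m) ≡ true
≡ᵇ-refl m = Equivalence.to T-≡ (≡⇒≡ᵇ m m refl)

iter-suc : ∀ (g : ℕ → ℕ) k x → iter g (suc k) x ≡ iter g k (g x)
iter-suc g zero    x = refl
iter-suc g (suc k) x = cong g (iter-suc g k x)

iter-cong-on : ∀ (Q : ℕ → Set) {g h : ℕ → ℕ} → (∀ x → Q x → Q (h x)) →
  (∀ x → Q x → g x ≡ h x) → ∀ k x → Q x → iter g k x ≡ iter h k x
iter-cong-on Q h-closed g≗h zero    x q = refl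
iter-cong-on Q {g} {h} h-closed g≗h (suc k) x q = begin
  iter g (suc k) x  ≡⟨ iter-suc g k x ⟩
  iter g k (g x)    ≡⟨ cong (iter g k) (g≗h x q) ⟩
  iter g k (h x)    ≡⟨ iter-cong-on Q h-closed g≗h k (h x) (h-closed x q) ⟩
  iter h k (h x)    ≡⟨ sym (iter-suc h k x) ⟩
  iter h (suc k) x  ∎

iter-orbit₂ : ∀ (τ : ℕ → ℕ) a → τ (τ a) ≡ a ⊎ τ (τ a) ≡ τ a →
  ∀ k → iter τ k a ≡ a ⊎ iter τ k a ≡ τ a
iter-orbit₂ τ a period zero = inj₁ refl
iter-orbit₂ τ a period (suc k) with iter-orbit₂ τ a period k
... | inj₁ eq = inj₂ (cong τ eq)
... | inj₂ eq = ⊎-map (trans (cong τ eq)) (trans (cong τ eq)) period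

pigeonhole₂ : ∀ {A : Set} {a b u v w : A} →
  u ≡ a ⊎ u ≡ b → v ≡ a ⊎ v ≡ b → w ≡ a ⊎ w ≡ b → u ≡ v ⊎ v ≡ w ⊎ u ≡ w
pigeonhole₂ (inj₁ refl) (inj₁ refl) _           = inj₁ refl
pigeonhole₂ (inj₂ refl) (inj₂ refl) _           = inj₁ refl
pigeonhole₂ (inj₁ refl) (inj₂ refl) (inj₁ refl) = inj₂ (inj₂ refl)
pigeonhole₂ (inj₁ refl) (inj₂ refl) (inj₂ refl) = inj₂ (inj₁ refl)
pigeonhole₂ (inj₂ refl) (inj₁ refl) (inj₁ refl) = inj₂ (inj₁ refl)
pigeonhole₂ (inj₂ refl) (inj₁ refl) (inj₂ refl) = inj₂ (inj₂ refl)

module _ {A : Set} where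

  ∈⇒1≤length : ∀ {L : List A} {x} → x ∈ L → 1 ≤ length L
  ∈⇒1≤length (here _)  = s≤s z≤n
  ∈⇒1≤length (there _) = s≤s z≤n

  distinct²⇒2≤length : ∀ {L : List A} {x y} → x ∈ L → y ∈ L → x ≢ y → 2 ≤ length L
  distinct²⇒2≤length (here refl) (here refl) x≢y = ⊥-elim (x≢y refl)
  distinct²⇒2≤length (here _)    (there y∈) _   = s≤s (∈⇒1≤length y∈)
  distinct²⇒2≤length (there x∈)  (here _)   _   = s≤s (∈⇒1≤length x∈)
  distinct²⇒2≤length (there x∈)  (there y∈) x≢y = m≤n⇒m≤1+n (distinct²⇒2≤length x∈ y∈ x≢y)

  distinct³⇒3≤length : ∀ {L : List A} {x y z} → x ∈ L → y ∈ L → z ∈ L →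
    x ≢ y → y ≢ z → x ≢ z → 3 ≤ length L
  distinct³⇒3≤length (here refl) (here refl) _ x≢y _ _ = ⊥-elim (x≢y refl)
  distinct³⇒3≤length (here refl) (there _) (here refl) _ _ x≢z = ⊥-elim (x≢z refl)
  distinct³⇒3≤length (there _) (here refl) (here refl) _ y≢z _ = ⊥-elim (y≢z refl)
  distinct³⇒3≤length (here _) (there y∈) (there z∈) _ y≢z _ = s≤s (distinct²⇒2≤length y∈ z∈ y≢z)
  distinct³⇒3≤length (there x∈) (here _) (there z∈) _ _ x≢z = s≤s (distinct²⇒2≤length x∈ z∈ x≢z)
  distinct³⇒3≤length (there x∈) (there y∈) (here _) x≢y _ _ = s≤s (distinct²⇒2≤length x∈ y∈ x≢y)
  distinct³⇒3≤length (there x∈) (there y∈) (there z∈) x≢y y≢z x≢z =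
    m≤n⇒m≤1+n (distinct³⇒3≤length x∈ y∈ z∈ x≢y y≢z x≢z)

restrictWith-agree : ∀ k {μ ν : ℕ → ℕ} {P : ℕ → Bool} → (∀ y → P y ≡ false → μ y ≡ ν y) →
  ∀ {x} → P x ≡ false → restrictWith k μ P x ≡ restrictWith k ν P x
restrictWith-agree zero    μ≗ν px = refl
restrictWith-agree (suc k) {ν = ν} {P} μ≗ν {x} px rewrite μ≗ν x px with P (ν x) in p
... | true  = refl
... | false = restrictWith-agree k μ≗ν p

restrictWith-cong : ∀ {k} {μ ν : ℕ → ℕ} {P : ℕ → Bool} {c x} → 0 < k →
  (∀ y → P y ≡ false → μ y ≡ ν y) → μ c ≡ ν x → restrictWith k μ P c ≡ restrictWith k ν P x
restrictWith-cong {suc k} {ν = ν} {P} {x = x} _ μ≗ν eq rewrite eq with P (ν x) in p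
... | true  = refl
... | false = restrictWith-agree k μ≗ν p

-- FirstKept τ P d x y: y = τ^(d+1) x is the first point after x on its τ-orbit where P holds,
-- i.e. y is the image of x under the restriction of τ to P.
data FirstKept (τ : ℕ → ℕ) (P : ℕ → Bool) : ℕ → ℕ → ℕ → Set where
  now  : ∀ {x} → P (τ x) ≡ true → FirstKept τ P zero x (τ x)
  skip : ∀ {d x y} → P (τ x) ≡ false → FirstKept τ P d (τ x) y → FirstKept τ P (suc d) x y

module _ {τ : ℕ → ℕ} {P : ℕ → Bool} where

  FirstKept-kept : ∀ {d x y} → FirstKept τ P d x y → P y ≡ true
  FirstKept-kept (now p)    = p
  FirstKept-kept (skip _ r) = FirstKept-kept r

  FirstKept-∈ : ∀ {B : List ℕ} → (∀ b → b ∈ B → τ b ∈ B) →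
    ∀ {d x y} → x ∈ B → FirstKept τ P d x y → y ∈ B
  FirstKept-∈ closed x∈ (now _)    = closed _ x∈
  FirstKept-∈ closed x∈ (skip _ r) = FirstKept-∈ closed (closed _ x∈) r

  restrictWith-FirstKept : ∀ {d x y k} → FirstKept τ P d x y → d < k → restrictWith k τ P x ≡ y
  restrictWith-FirstKept {k = suc k} (now p)    _          rewrite p = refl
  restrictWith-FirstKept {k = suc k} (skip p r) (s≤s d<k) rewrite p = restrictWith-FirstKept r d<k

  FirstKept-shortcut : ∀ {d x y c} → FirstKept τ P d x y → P c ≡ true →
    ∀ k → iter τ (suc k) x ≡ c → ∃ λ k′ → k′ ≤ k × iter τ k′ y ≡ c
  FirstKept-shortcut {x = x} (now _) _ k eq = k , ≤-refl , trans (sym (iter-suc τ k x)) eq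
  FirstKept-shortcut (skip p _) pc zero eq = ⊥-elim (≡true⇒≢false (trans (cong P eq) pc) p)
  FirstKept-shortcut {x = x} (skip _ r) pc (suc k) eq
    with FirstKept-shortcut r pc k (trans (sym (iter-suc τ (suc k) x)) eq)
  ... | k′ , k′≤k , eq′ = k′ , m≤n⇒m≤1+n k′≤k , eq′

module CycleRestriction (B : List ℕ) (τ : ℕ → ℕ) (P : ℕ → Bool) (n : ℕ)
  (closed : ∀ b → b ∈ B → τ b ∈ B)
  (firstKept : ∀ x → x ∈ B → P x ≡ true → ∃₂ λ d y → d < n × FirstKept τ P d x y) where

  Kept : ℕ → Set
  Kept x = x ∈ B × P x ≡ true

  R : ℕ → ℕ
  R = restrictWith n τ P

  R-kept : ∀ x → Kept x → Kept (R x)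
  R-kept x (x∈ , px) with firstKept x x∈ px
  ... | _ , _ , d<n , r = subst Kept (sym (restrictWith-FirstKept r d<n)) (FirstKept-∈ closed x∈ r , FirstKept-kept r)

  R-reaches : ∀ {k} → Acc _<_ k → ∀ {x c} → Kept x → P c ≡ true → iter τ k x ≡ c →
    ∃ λ k′ → iter R k′ x ≡ c
  R-reaches {zero}  _         _          _  eq = zero , eq
  R-reaches {suc k} (acc rec) {x} {c} (x∈ , px) pc eq with firstKept x x∈ px
  ... | _ , y , d<n , r with FirstKept-shortcut r pc k eq
  ... | k′ , k′≤k , eq′ with R-reaches (rec (s≤s k′≤k)) (FirstKept-∈ closed x∈ r , FirstKept-kept r) pc eq′
  ... | k″ , eq″ = suc k″ , (begin
    iter R (suc k″) x  ≡⟨ iter-suc R k″ x ⟩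
    iter R k″ (R x)    ≡⟨ cong (iter R k″) (restrictWith-FirstKept r d<n) ⟩
    iter R k″ y        ≡⟨ eq″ ⟩
    c                  ∎)

  R-connects : ∀ {x c} → Kept x → Kept c → (∃ λ k → iter τ k x ≡ c) → ∃ λ k′ → iter R k′ x ≡ c
  R-connects kx (_ , pc) (k , eq) = R-reaches (<-wellFounded k) kx pc eq

module _ {B : List ℕ} {τ : ℕ → ℕ} {P : ℕ → Bool} {a b : ℕ}
  (closed : ∀ x → x ∈ B → τ x ∈ B)
  (cyclic : ∀ x y → x ∈ B → y ∈ B → ∃ λ k → iter τ k x ≡ y)
  (removed : ∀ y → P y ≡ false → y ≡ a ⊎ y ≡ b) where

  -- Two of τ x, τ² x, τ³ x coincide, so the τ-orbit of τ x is {τ x, τ² x};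
  -- but it must contain x, which satisfies P.
  three-removed : ∀ x → x ∈ B → P x ≡ true →
    P (τ x) ≡ false → P (τ (τ x)) ≡ false → P (τ (τ (τ x))) ≡ false → ⊥
  three-removed x x∈ px p₁ p₂ p₃ with cyclic (τ x) x (closed x x∈) x∈
  ... | k , τᵏ⁺¹x≡x = [ lands-on p₁ , lands-on p₂ ]′ (iter-orbit₂ τ (τ x) period k)
    where
    period : τ (τ (τ x)) ≡ τ x ⊎ τ (τ (τ x)) ≡ τ (τ x)
    period with pigeonhole₂ (removed _ p₁) (removed _ p₂) (removed _ p₃)
    ... | inj₁ eq        = inj₂ (cong τ (sym eq))
    ... | inj₂ (inj₁ eq) = inj₂ (sym eq)
    ... | inj₂ (inj₂ eq) = inj₁ (sym eq)
    lands-on : ∀ {z} → P z ≡ false → iter τ k (τ x) ≡ z → ⊥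
    lands-on pz eq = ≡true⇒≢false (trans (cong P (trans (sym eq) τᵏ⁺¹x≡x)) px) pz

  firstKept-within3 : ∀ x → x ∈ B → P x ≡ true → ∃₂ λ d y → d < 3 × FirstKept τ P d x y
  firstKept-within3 x x∈ px with P (τ x) in p₁
  ... | true = _ , _ , s≤s z≤n , now p₁
  ... | false with P (τ (τ x)) in p₂
  ... | true = _ , _ , s≤s (s≤s z≤n) , skip p₁ (now p₂)
  ... | false with P (τ (τ (τ x))) in p₃
  ... | true  = _ , _ , s≤s (s≤s (s≤s z≤n)) , skip p₁ (skip p₂ (now p₃))
  ... | false = ⊥-elim (three-removed x x∈ px p₁ p₂ p₃)

tour-∈ : ∀ M S {b} → S b ≡ true → tour M S b ≡ σ M (α M b)
tour-∈ M S p rewrite p = refl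

tour-∉ : ∀ M S {b} → S b ≡ false → tour M S b ≡ σ M b
tour-∉ M S p rewrite p = refl

tour-cong : ∀ M {S₁ S₂ b} → S₁ b ≡ S₂ b → tour M S₁ b ≡ tour M S₂ b
tour-cong M {b = b} = cong (λ s → if s then σ M (α M b) else σ M b)

module EdgeRemoval (M : PreMap) (isMap : IsMap M) (S : EdgeSet) (qt : IsQuasiTree M S)
  (f : ℕ) (f∈B : f ∈ flags M) where

  open IsMap isMap

  B : List ℕ
  B = flags M

  P : ℕ → Bool
  P = notInEdge M f

  τ : ℕ → ℕ
  τ = tour M S

  n : ℕ
  n = length B

  edge⇒removed : ∀ {y} → y ≡ f ⊎ y ≡ α M f → P y ≡ false
  edge⇒removed (inj₁ refl) = cong (λ t → not (t ∨ (f ≡ᵇ α M f))) (≡ᵇ-refl f)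
  edge⇒removed (inj₂ refl) =
    cong not (trans (cong ((α M f ≡ᵇ f) ∨_) (≡ᵇ-refl (α M f))) (∨-zeroʳ (α M f ≡ᵇ f)))

  removed⇒edge : ∀ y → P y ≡ false → y ≡ f ⊎ y ≡ α M f
  removed⇒edge y py with y ≡ᵇ f in e₁ | y ≡ᵇ α M f in e₂
  ... | true  | _    = inj₁ (≡ᵇ⇒≡ y f (Equivalence.from T-≡ e₁))
  ... | false | true = inj₂ (≡ᵇ⇒≡ y (α M f) (Equivalence.from T-≡ e₂))
  removed⇒edge y () | false | false

  S-edge : ∀ {y} → y ≡ f ⊎ y ≡ α M f → S y ≡ S f
  S-edge (inj₁ refl) = refl
  S-edge (inj₂ refl) = proj₁ qt f f∈B

  α-kept : ∀ x → x ∈ B → P x ≡ true → P (α M x) ≡ true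
  α-kept x x∈ px with P (α M x) in pαx
  ... | true  = refl
  ... | false = ⊥-elim (≡true⇒≢false px (edge⇒removed (partner (removed⇒edge _ pαx))))
    where
    partner : α M x ≡ f ⊎ α M x ≡ α M f → x ≡ f ⊎ x ≡ α M f
    partner (inj₁ αx≡f)  = inj₂ (trans (sym (α-invol x x∈)) (cong (α M) αx≡f))
    partner (inj₂ αx≡αf) = inj₁ (trans (sym (α-invol x x∈)) (trans (cong (α M) αx≡αf) (α-invol f f∈B)))

  3≤n : ∀ {x} → x ∈ B → P x ≡ true → 3 ≤ n
  3≤n {x} x∈ px = distinct³⇒3≤length x∈ f∈B (proj₁ α-perm f f∈B)
    (λ { refl → ≡true⇒≢false px (edge⇒removed (inj₁ refl)) })
    (λ f≡αf → α-fpf f f∈B (sym f≡αf))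
    (λ { refl → ≡true⇒≢false px (edge⇒removed (inj₂ refl)) })

  firstKept : ∀ x → x ∈ B → P x ≡ true → ∃₂ λ d y → d < n × FirstKept τ P d x y
  firstKept x x∈ px with firstKept-within3 (proj₁ (proj₂ qt)) (proj₂ (proj₂ qt)) removed⇒edge x x∈ px
  ... | d , y , d<3 , r = d , y , <-≤-trans d<3 (3≤n x∈ px) , r

  open CycleRestriction B τ P n (proj₁ (proj₂ qt)) firstKept

  α-Kept : ∀ x → Kept x → Kept (α M x)
  α-Kept x (x∈ , px) = proj₁ α-perm x x∈ , α-kept x x∈ px

  0<n : ∀ {x} → Kept x → 0 < n
  0<n (x∈ , _) = ∈⇒1≤length x∈

  α| : ℕ → ℕ
  α| = restrict B (α M) P

  α|-kept : ∀ x → Kept x → α| x ≡ α M x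
  α|-kept x kx = restrictWith-FirstKept (now (proj₂ (α-Kept x kx))) (0<n kx)

  α|-involutive : ∀ x → Kept x → α| (α| x) ≡ x
  α|-involutive x kx@(x∈ , _) = begin
    α| (α| x)     ≡⟨ cong α| (α|-kept x kx) ⟩
    α| (α M x)    ≡⟨ α|-kept (α M x) (α-Kept x kx) ⟩
    α M (α M x)   ≡⟨ α-invol x x∈ ⟩
    x             ∎

  ∈-flagsMinus⁻ : ∀ {x} → x ∈ flagsMinus M f → Kept x
  ∈-flagsMinus⁻ x∈ with ∈-filter⁻ _ x∈
  ... | x∈B , px = x∈B , Equivalence.to T-≡ px

  ∈-flagsMinus⁺ : ∀ {x} → Kept x → x ∈ flagsMinus M f
  ∈-flagsMinus⁺ (x∈ , px) = ∈-filter⁺ _ x∈ (Equivalence.from T-≡ px)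

  -- Both M ∖ e and M / e have this shape; only their vertex permutations differ.
  minor : (ℕ → ℕ) → PreMap
  minor σ′ = premap (flagsMinus M f) σ′ α|

  minor-removes-chord : (σ′ : ℕ → ℕ) (S′ : EdgeSet) →
    (∀ x → Kept x → S′ x ≡ S x) → (∀ x → Kept x → tour (minor σ′) S′ x ≡ R x) →
    IsQuasiTree (minor σ′) S′ × (Λ̃ (minor σ′) S′ ≈CD removeChord (Λ̃ M S) f)
  minor-removes-chord σ′ S′ S′≗S tour′≗R =
    (isEdgeSet , closed′ , cyclic′) , (λ _ → mk⇔ id id) , agree
    where
    isEdgeSet : IsEdgeSet (minor σ′) S′
    isEdgeSet x x∈ with ∈-flagsMinus⁻ x∈
    ... | kx@(x∈B , _) = begin
      S′ (α| x)    ≡⟨ cong S′ (α|-kept x kx) ⟩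
      S′ (α M x)   ≡⟨ S′≗S (α M x) (α-Kept x kx) ⟩
      S (α M x)    ≡⟨ proj₁ qt x x∈B ⟩
      S x          ≡⟨ sym (S′≗S x kx) ⟩
      S′ x         ∎

    closed′ : ∀ x → x ∈ flagsMinus M f → tour (minor σ′) S′ x ∈ flagsMinus M f
    closed′ x x∈ = subst (_∈ flagsMinus M f) (sym (tour′≗R x kx)) (∈-flagsMinus⁺ (R-kept x kx))
      where kx = ∈-flagsMinus⁻ x∈

    cyclic′ : ∀ x c → x ∈ flagsMinus M f → c ∈ flagsMinus M f →
      ∃ λ k → iter (tour (minor σ′) S′) k x ≡ c
    cyclic′ x c x∈ c∈ with ∈-flagsMinus⁻ x∈ | ∈-flagsMinus⁻ c∈
    ... | kx@(x∈B , _) | kc@(c∈B , _) with R-connects kx kc (proj₂ (proj₂ qt) x c x∈B c∈B)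
    ... | k , eq = k , trans (iter-cong-on Kept R-kept tour′≗R k x kx) eq

    agree : ∀ x → x ∈ flagsMinus M f →
      (tour (minor σ′) S′ x ≡ R x) × (α| x ≡ α| x)
      × ((if S′ x then colour1 else colour2) ≡ (if S x then colour1 else colour2))
    agree x x∈ = tour′≗R x kx , refl , cong (λ s → if s then colour1 else colour2) (S′≗S x kx)
      where kx = ∈-flagsMinus⁻ x∈

  module Contraction (f∈S : S f ≡ true) where

    σα : ℕ → ℕ
    σα y = σ M (α M y)

    σ/ : ℕ → ℕ
    σ/ b = restrict B σα P (α| b)

    S∖e : EdgeSet
    S∖e = removeFromEdgeSet M S f

    σα≗τ-removed : ∀ y → P y ≡ false → σα y ≡ τ y
    σα≗τ-removed y py = sym (tour-∈ M S (trans (S-edge (removed⇒edge y py)) f∈S))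

    S∖e≗S : ∀ x → Kept x → S∖e x ≡ S x
    S∖e≗S x (_ , px) = trans (cong (S x ∧_) px) (∧-identityʳ (S x))

    tour≗R : ∀ x → Kept x → tour (minor σ/) S∖e x ≡ R x
    tour≗R x kx@(x∈ , _) = trans (tour-cong (minor σ/) {S∖e} {S} (S∖e≗S x kx)) (by-colour (S x) refl)
      where
      by-colour : ∀ s → S x ≡ s → tour (minor σ/) S x ≡ R x
      by-colour true Sx = begin
        tour (minor σ/) S x                ≡⟨ tour-∈ (minor σ/) S Sx ⟩
        restrict B σα P (α| (α| x))        ≡⟨ cong (restrict B σα P) (α|-involutive x kx) ⟩
        restrict B σα P x                  ≡⟨ restrictWith-cong (0<n kx) σα≗τ-removed (sym (tour-∈ M S Sx)) ⟩
        R x                                ∎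
      by-colour false Sx = begin
        tour (minor σ/) S x                ≡⟨ tour-∉ (minor σ/) S Sx ⟩
        restrict B σα P (α| x)             ≡⟨ cong (restrict B σα P) (α|-kept x kx) ⟩
        restrict B σα P (α M x)            ≡⟨ restrictWith-cong (0<n kx) σα≗τ-removed σα[αx]≡τx ⟩
        R x                                ∎
        where
        σα[αx]≡τx : σα (α M x) ≡ τ x
        σα[αx]≡τx = trans (cong (σ M) (α-invol x x∈)) (sym (tour-∉ M S Sx))

    removes-chord : IsQuasiTree (contractEdge M f) S∖e
                  × (Λ̃ (contractEdge M f) S∖e ≈CD removeChord (Λ̃ M S) f)
    removes-chord = minor-removes-chord σ/ S∖e S∖e≗S tour≗R

  module Deletion (f∉S : S f ≡ false) where

    σ| : ℕ → ℕ
    σ| = restrict B (σ M) P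

    σ≗τ-removed : ∀ y → P y ≡ false → σ M y ≡ τ y
    σ≗τ-removed y py = sym (tour-∉ M S (trans (S-edge (removed⇒edge y py)) f∉S))

    tour≗R : ∀ x → Kept x → tour (minor σ|) S x ≡ R x
    tour≗R x kx = by-colour (S x) refl
      where
      by-colour : ∀ s → S x ≡ s → tour (minor σ|) S x ≡ R x
      by-colour true Sx = begin
        tour (minor σ|) S x  ≡⟨ tour-∈ (minor σ|) S Sx ⟩
        σ| (α| x)            ≡⟨ cong σ| (α|-kept x kx) ⟩
        σ| (α M x)           ≡⟨ restrictWith-cong (0<n kx) σ≗τ-removed (sym (tour-∈ M S Sx)) ⟩
        R x                  ∎
      by-colour false Sx = begin
        tour (minor σ|) S x  ≡⟨ tour-∉ (minor σ|) S Sx ⟩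
        σ| x                 ≡⟨ restrictWith-cong (0<n kx) σ≗τ-removed (sym (tour-∉ M S Sx)) ⟩
        R x                  ∎

    removes-chord : IsQuasiTree (deleteEdge M f) S × (Λ̃ (deleteEdge M f) S ≈CD removeChord (Λ̃ M S) f)
    removes-chord = minor-removes-chord σ| S (λ _ _ → refl) tour≗R

lemma10 : (M : PreMap) → IsMap M → (S : EdgeSet) → IsQuasiTree M S →
    (f : ℕ) → f ∈ flags M →
    ((S f ≡ true →
        IsQuasiTree (contractEdge M f) (removeFromEdgeSet M S f)
        × (Λ̃ (contractEdge M f) (removeFromEdgeSet M S f) ≈CD removeChord (Λ̃ M S) f))
    × (S f ≡ false →
        IsQuasiTree (deleteEdge M f) S
        × (Λ̃ (deleteEdge M f) S ≈CD removeChord (Λ̃ M S) f)))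
lemma10 M isMap S qt f f∈B = Contraction.removes-chord , Deletion.removes-chord
  where open EdgeRemoval M isMap S qt f f∈B
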